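{- Let $p$ be a prime and let $\varepsilon$, $a \geq 1$, $b \geq 0$ be integers. Define, for integers $n \geq 0$, \[ u_{a,b}^{\varepsilon}(n) = \sum_{k=0}^{n} (-1)^{\varepsilon k} \binom{n}{k}^{a} \binom{2n}{k}^{b}. \] Then \[ u_{a,b}^{\varepsilon}(pn+k) \equiv u_{a,b}^{\varepsilon}(n)\, u_{a,b}^{\varepsilon}(k) \pmod{p} \] for all integers $n, k \geq 0$ with $k < p/2$. -}

module Defs where

open import Data.Nat using (ℕ; zero; suc)
import Data.Nat as ℕ
open import Data.Nat.Combinatorics using (_C_)
open import Data.Integer using (ℤ; +_; -_; _+_; _*_)
open import Data.Integer.Base using (_^_)
open import Data.Bool using (if_then_else_)
open import Data.Integer using () renaming (∣_∣ to ∣_∣ᵢ)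
import Data.Nat.Base as NB

-- (-1)^m for an integer exponent m: determined by the parity of m
-- (valid also for negative m, since (-1)^{-1} = -1).
negOnePow : ℤ → ℤ
negOnePow m = if (∣ m ∣ᵢ NB.% 2) NB.≡ᵇ 0 then + 1 else - (+ 1)

sumTo : ℕ → (ℕ → ℤ) → ℤ
sumTo zero f = f 0
sumTo (suc n) f = sumTo n f + f (suc n)

u : ℤ → ℕ → ℕ → ℕ → ℤ
u ε a b n = sumTo n (λ k →
  negOnePow (ε * + k) * ((+ (n C k)) ^ a) * ((+ ((2 ℕ.* n) C k)) ^ b))

{-# OPTIONS --safe #-}

-- Lucas' theorem gives C(pn+k, pm+r) ≡ C(n,m) C(k,r) (mod p) for k, r < p; as 2k < p,
-- 2(pn+k) = p(2n) + 2k also has last base-p digit 2k, so C(2(pn+k), pm+r) ≡ C(2n,m) C(2k,r).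
-- With s = (-1)^|ε| one has s^p ≡ s (mod p), so s^(pm+r) ≡ s^m s^r, and hence the term of
-- u(pn+k) at index pm+r is congruent to the product of the terms of u(n) at m and of u(k) at r.
-- Since a ≥ 1 the terms vanish beyond the top index, so u(pn+k) may be summed over all
-- pm+r < p(n+1), i.e. over all pairs m ≤ n, r < p, and the double sum factors as u(n) u(k).

module Submission where

open import Defs
open import Data.Nat using (ℕ; _≤_; _<_)
import Data.Nat as ℕ
open import Data.Nat.Primality using (Prime)
open import Data.Integer using (ℤ; +_; _-_; _*_)
open import Data.Integer.Divisibility using (_∣_)

open import Level using (0ℓ)
open import Data.Empty using (⊥-elim)
open import Data.Sum as Sum using (_⊎_; inj₁; inj₂; [_,_]′)
open import Data.Nat using (zero; suc; pred; >-nonZero⁻¹; _∸_; _!; NonZero; z<s; _≤′_; ≤′-refl; ≤′-step)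
import Data.Nat.Properties as ℕP
open import Data.Nat.Properties using (_!*_!≢0)
open import Data.Nat.DivMod using (m/n*n≡m)
open import Data.Nat.Divisibility using (_∣0; ∣-refl; ∣m∣n⇒∣m+n; m∣m*n; ∣⇒≤; ∣1⇒≡1)
  renaming (_∣_ to _∣ℕ_)
open import Data.Nat.Primality using (¬prime[1]; euclidsLemma; prime⇒irreducible; prime⇒nonZero)
open import Data.Nat.Combinatorics using (_C_; k![n∸k]!∣n!; nCk+nC[k+1]≡[n+1]C[k+1]; nCn≡1)
open import Data.Nat.Combinatorics.Specification using (nCk≡n!/k![n-k]!; k>n⇒nCk≡0)
open import Data.Nat.Tactic.RingSolver using () renaming (solve-∀ to ℕ-solve-∀)
open import Data.Integer using (-_; _+_; 0ℤ; 1ℤ; -1ℤ; ∣_∣; _^_)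
import Data.Integer.Properties as ℤP
import Data.Integer.Divisibility.Signed as Signed
open import Data.Integer.Tactic.RingSolver using (solve-∀)
open import Algebra.Properties.CommutativeSemigroup ℤP.+-commutativeSemigroup
  using () renaming (interchange to +-interchange; x∙yz≈y∙xz to x+[y+z]≡y+[x+z])
open import Algebra.Properties.CommutativeSemigroup ℤP.*-commutativeSemigroup
  using () renaming (interchange to *-interchange)
open import Relation.Binary.Bundles using (Setoid)
import Relation.Binary.Reasoning.Setoid as SetoidReasoning
open import Relation.Binary.PropositionalEquality
  using (_≡_; refl; sym; trans; cong; cong₂; subst; module ≡-Reasoning)
open import Relation.Nullary using (¬_)
open import Function using (id; _∘_)

infix 4 _≡_[mod_]

record _≡_[mod_] (x y : ℤ) (m : ℕ) : Set where
  constructor mk≡mod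
  field
    m∣x-y : + m Signed.∣ x - y

open _≡_[mod_] using (m∣x-y)

module _ {m : ℕ} where

  ≡-mod-reflexive : ∀ {x y} → x ≡ y → x ≡ y [mod m ]
  ≡-mod-reflexive {x} refl = mk≡mod (Signed.divides 0ℤ (ℤP.+-inverseʳ x))

  ≡-mod-refl : ∀ {x} → x ≡ x [mod m ]
  ≡-mod-refl = ≡-mod-reflexive refl

  ≡-mod-sym : ∀ {x y} → x ≡ y [mod m ] → y ≡ x [mod m ]
  ≡-mod-sym {x} {y} (mk≡mod m∣x-y) =
    mk≡mod (subst (+ m Signed.∣_) (-[x-y]≡y-x x y) (Signed.∣m⇒∣-m m∣x-y))
    where
    -[x-y]≡y-x : ∀ x y → - (x - y) ≡ y - x
    -[x-y]≡y-x = solve-∀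

  ≡-mod-trans : ∀ {x y z} → x ≡ y [mod m ] → y ≡ z [mod m ] → x ≡ z [mod m ]
  ≡-mod-trans {x} {y} {z} (mk≡mod m∣x-y) (mk≡mod m∣y-z) =
    mk≡mod (subst (+ m Signed.∣_) ([x-y]+[y-z]≡x-z x y z) (Signed.∣m∣n⇒∣m+n m∣x-y m∣y-z))
    where
    [x-y]+[y-z]≡x-z : ∀ x y z → (x - y) + (y - z) ≡ x - z
    [x-y]+[y-z]≡x-z = solve-∀

  +-cong-mod : ∀ {x y u v} → x ≡ y [mod m ] → u ≡ v [mod m ] → x + u ≡ y + v [mod m ]
  +-cong-mod {x} {y} {u} {v} (mk≡mod m∣x-y) (mk≡mod m∣u-v) =
    mk≡mod (subst (+ m Signed.∣_) (difference-of-sums x y u v) (Signed.∣m∣n⇒∣m+n m∣x-y m∣u-v))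
    where
    difference-of-sums : ∀ x y u v → (x - y) + (u - v) ≡ (x + u) - (y + v)
    difference-of-sums = solve-∀

  *-cong-mod : ∀ {x y u v} → x ≡ y [mod m ] → u ≡ v [mod m ] → x * u ≡ y * v [mod m ]
  *-cong-mod {x} {y} {u} {v} (mk≡mod m∣x-y) (mk≡mod m∣u-v) =
    mk≡mod (subst (+ m Signed.∣_) (difference-of-products x y u v)
      (Signed.∣m∣n⇒∣m+n (Signed.∣m⇒∣m*n u m∣x-y) (Signed.∣n⇒∣m*n y m∣u-v)))
    where
    difference-of-products : ∀ x y u v → (x - y) * u + y * (u - v) ≡ x * u - y * v
    difference-of-products = solve-∀

  ^-cong-mod : ∀ {x y} n → x ≡ y [mod m ] → x ^ n ≡ y ^ n [mod m ]
  ^-cong-mod zero    x≡y = ≡-mod-refl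
  ^-cong-mod (suc n) x≡y = *-cong-mod x≡y (^-cong-mod n x≡y)

≡-mod-setoid : ℕ → Setoid 0ℓ 0ℓ
≡-mod-setoid m = record
  { Carrier       = ℤ
  ; _≈_           = _≡_[mod m ]
  ; isEquivalence = record { refl = ≡-mod-refl ; sym = ≡-mod-sym ; trans = ≡-mod-trans }
  }

module ≡-mod-Reasoning (m : ℕ) = SetoidReasoning (≡-mod-setoid m)

∣⇒≡0-mod : ∀ {p n} → p ∣ℕ n → + n ≡ 0ℤ [mod p ]
∣⇒≡0-mod {p} {n} p∣n =
  mk≡mod (subst (+ p Signed.∣_) (sym (ℤP.+-identityʳ (+ n))) (Signed.∣ᵤ⇒∣ p∣n))

^-distribʳ-* : ∀ x y n → (x * y) ^ n ≡ x ^ n * y ^ n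
^-distribʳ-* x y zero    = refl
^-distribʳ-* x y (suc n) =
  trans (cong ((x * y) *_) (^-distribʳ-* x y n)) (*-interchange x y (x ^ n) (y ^ n))

-- Finite sums

∑ : ℕ → (ℕ → ℤ) → ℤ
∑ zero    f = 0ℤ
∑ (suc n) f = ∑ n f + f n

infix 5 ∑
syntax ∑ n (λ i → e) = ∑[ i < n ] e

sumTo≡∑ : ∀ n f → sumTo n f ≡ ∑ (suc n) f
sumTo≡∑ zero    f = sym (ℤP.+-identityˡ (f 0))
sumTo≡∑ (suc n) f = cong (_+ f (suc n)) (sumTo≡∑ n f)

∑-cong : ∀ n {f g} → (∀ i → f i ≡ g i) → ∑ n f ≡ ∑ n g
∑-cong zero    f≡g = refl
∑-cong (suc n) f≡g = cong₂ _+_ (∑-cong n f≡g) (f≡g n)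

∑-cong-mod : ∀ {m} n {f g} → (∀ i → i < n → f i ≡ g i [mod m ]) → ∑ n f ≡ ∑ n g [mod m ]
∑-cong-mod zero    f≡g = ≡-mod-refl
∑-cong-mod (suc n) f≡g =
  +-cong-mod (∑-cong-mod n (λ i i<n → f≡g i (ℕP.m<n⇒m<1+n i<n))) (f≡g n (ℕP.n<1+n n))

∑-vanishing-tail : ∀ {m n} f → m ≤ n → (∀ i → m ≤ i → f i ≡ 0ℤ) → ∑ n f ≡ ∑ m f
∑-vanishing-tail {m} f m≤n f≡0 = go (ℕP.≤⇒≤′ m≤n)
  where
  go : ∀ {n} → m ≤′ n → ∑ n f ≡ ∑ m f
  go ≤′-refl             = refl
  go (≤′-step {n} m≤′n) =
    trans (cong₂ _+_ (go m≤′n) (f≡0 n (ℕP.≤′⇒≤ m≤′n))) (ℤP.+-identityʳ (∑ m f))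

∑-+ : ∀ m n f → ∑ (m ℕ.+ n) f ≡ ∑ m f + (∑[ i < n ] f (m ℕ.+ i))
∑-+ m zero    f = trans (cong (λ l → ∑ l f) (ℕP.+-identityʳ m)) (sym (ℤP.+-identityʳ (∑ m f)))
∑-+ m (suc n) f = begin
  ∑ (m ℕ.+ suc n) f                                ≡⟨ cong (λ l → ∑ l f) (ℕP.+-suc m n) ⟩
  ∑ (m ℕ.+ n) f + f (m ℕ.+ n)                      ≡⟨ cong (_+ f (m ℕ.+ n)) (∑-+ m n f) ⟩
  (∑ m f + (∑[ i < n ] f (m ℕ.+ i))) + f (m ℕ.+ n) ≡⟨ ℤP.+-assoc (∑ m f) _ _ ⟩
  ∑ m f + (∑[ i < suc n ] f (m ℕ.+ i))             ∎
  where open ≡-Reasoning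

∑-* : ∀ m n f → ∑ (m ℕ.* n) f ≡ ∑[ i < n ] ∑[ j < m ] f (m ℕ.* i ℕ.+ j)
∑-* m zero    f = cong (λ l → ∑ l f) (ℕP.*-zeroʳ m)
∑-* m (suc n) f = begin
  ∑ (m ℕ.* suc n) f                              ≡⟨ cong (λ l → ∑ l f) m*[1+n]≡m*n+m ⟩
  ∑ (m ℕ.* n ℕ.+ m) f                            ≡⟨ ∑-+ (m ℕ.* n) m f ⟩
  ∑ (m ℕ.* n) f + (∑[ j < m ] f (m ℕ.* n ℕ.+ j)) ≡⟨ cong (_+ (∑[ j < m ] f (m ℕ.* n ℕ.+ j))) (∑-* m n f) ⟩
  ∑[ i < suc n ] ∑[ j < m ] f (m ℕ.* i ℕ.+ j)    ∎
  where
  open ≡-Reasoning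
  m*[1+n]≡m*n+m : m ℕ.* suc n ≡ m ℕ.* n ℕ.+ m
  m*[1+n]≡m*n+m = trans (ℕP.*-suc m n) (ℕP.+-comm m (m ℕ.* n))

*-distribˡ-∑ : ∀ x n f → x * ∑ n f ≡ ∑[ i < n ] x * f i
*-distribˡ-∑ x zero    f = ℤP.*-zeroʳ x
*-distribˡ-∑ x (suc n) f =
  trans (ℤP.*-distribˡ-+ x (∑ n f) (f n)) (cong (_+ x * f n) (*-distribˡ-∑ x n f))

*-distribʳ-∑ : ∀ x n f → ∑ n f * x ≡ ∑[ i < n ] f i * x
*-distribʳ-∑ x zero    f = ℤP.*-zeroˡ x
*-distribʳ-∑ x (suc n) f =
  trans (ℤP.*-distribʳ-+ x (∑ n f) (f n)) (cong (_+ f n * x) (*-distribʳ-∑ x n f))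

∑*∑ : ∀ m n f g → ∑ m f * ∑ n g ≡ ∑[ i < m ] ∑[ j < n ] f i * g j
∑*∑ m n f g = trans (*-distribʳ-∑ (∑ n g) m f) (∑-cong m (λ i → *-distribˡ-∑ (f i) n g))

-- Binomial coefficients modulo a prime

_Cℤ_ : ℕ → ℕ → ℤ
n Cℤ k = + (n C k)

pascal : ∀ n k .{{_ : NonZero k}} → n Cℤ pred k + n Cℤ k ≡ suc n Cℤ k
pascal n (suc k) =
  trans (sym (ℤP.pos-+ (n C k) (n C suc k))) (cong +_ (nCk+nC[k+1]≡[n+1]C[k+1] n k))

nCk*k![n∸k]!≡n! : ∀ {n k} → k ≤ n → (n C k) ℕ.* (k ! ℕ.* (n ∸ k) !) ≡ n !
nCk*k![n∸k]!≡n! {n} {k} k≤n =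
  trans (cong (ℕ._* (k ! ℕ.* (n ∸ k) !)) (nCk≡n!/k![n-k]! k≤n)) (m/n*n≡m (k![n∸k]!∣n! k≤n))
  where instance _ = k !* (n ∸ k) !≢0

n∣n! : ∀ n .{{_ : NonZero n}} → n ∣ℕ n !
n∣n! (suc n) = m∣m*n (n !)

prime∤m! : ∀ {p m} → Prime p → m < p → ¬ (p ∣ℕ m !)
prime∤m! {m = zero}  p-prime _   p∣1 = ¬prime[1] (subst Prime (∣1⇒≡1 p∣1) p-prime)
prime∤m! {m = suc m} p-prime m<p p∣[1+m]! with euclidsLemma (suc m) (m !) p-prime p∣[1+m]!
... | inj₁ p∣1+m = ℕP.<⇒≱ m<p (∣⇒≤ p∣1+m)
... | inj₂ p∣m!  = prime∤m! p-prime (ℕP.<-trans (ℕP.n<1+n m) m<p) p∣m!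

prime∣pCk : ∀ {p k} → Prime p → 0 < k → k < p → p ∣ℕ p C k
prime∣pCk {p} {k} p-prime 0<k k<p =
  [ id , ⊥-elim ∘ p∤k!*[p∸k]! ]′ (euclidsLemma (p C k) (k ! ℕ.* (p ∸ k) !) p-prime p∣pCk*k!*[p∸k]!)
  where
  instance _ = prime⇒nonZero p-prime
  p∣pCk*k!*[p∸k]! : p ∣ℕ (p C k) ℕ.* (k ! ℕ.* (p ∸ k) !)
  p∣pCk*k!*[p∸k]! = subst (p ∣ℕ_) (sym (nCk*k![n∸k]!≡n! (ℕP.<⇒≤ k<p))) (n∣n! p)
  p∤k!*[p∸k]! : ¬ (p ∣ℕ k ! ℕ.* (p ∸ k) !)
  p∤k!*[p∸k]! = [ prime∤m! p-prime k<p , prime∤m! p-prime (ℕP.∸-monoʳ-< 0<k (ℕP.<⇒≤ k<p)) ]′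
              ∘ euclidsLemma (k !) ((p ∸ k) !) p-prime

m*[1+n]+o≡m*n+o+m : ∀ m n o → m ℕ.* suc n ℕ.+ o ≡ m ℕ.* n ℕ.+ o ℕ.+ m
m*[1+n]+o≡m*n+o+m = ℕ-solve-∀

module _ {p : ℕ} (p-prime : Prime p) where

  private instance _ = prime⇒nonZero p-prime
  open ≡-mod-Reasoning p

  -- Coefficientwise, (1 + x) ^ (n + p) ≡ (1 + x) ^ n * (1 + x ^ p) [mod p ].

  [n+p]Ck≡nCk : ∀ n k → k < p → (n ℕ.+ p) Cℤ k ≡ n Cℤ k [mod p ]
  [n+p]Ck≡nCk zero    zero    _   = ≡-mod-refl
  [n+p]Ck≡nCk zero    (suc k) k<p = ∣⇒≡0-mod (prime∣pCk p-prime z<s k<p)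
  [n+p]Ck≡nCk (suc n) zero    _   = ≡-mod-refl
  [n+p]Ck≡nCk (suc n) (suc k) k<p = begin
    suc (n ℕ.+ p) Cℤ suc k                ≡⟨ pascal (n ℕ.+ p) (suc k) ⟨
    (n ℕ.+ p) Cℤ k + (n ℕ.+ p) Cℤ suc k   ≈⟨ +-cong-mod ([n+p]Ck≡nCk n k (ℕP.<-trans (ℕP.n<1+n k) k<p))
                                                        ([n+p]Ck≡nCk n (suc k) k<p) ⟩
    n Cℤ k + n Cℤ suc k                   ≡⟨ pascal n (suc k) ⟩
    suc n Cℤ suc k                        ∎

  [n+p]C[k+p]≡nCk+nC[k+p] : ∀ n k → (n ℕ.+ p) Cℤ (k ℕ.+ p) ≡ n Cℤ k + n Cℤ (k ℕ.+ p) [mod p ]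
  [n+p]C[k+p]≡nCk+nC[k+p] zero zero
    rewrite nCn≡1 p | k>n⇒nCk≡0 {0} {p} (>-nonZero⁻¹ p) = ≡-mod-refl
  [n+p]C[k+p]≡nCk+nC[k+p] zero (suc k)
    rewrite k>n⇒nCk≡0 {p} {suc k ℕ.+ p} (ℕP.m<n+m p z<s) = ≡-mod-refl
  [n+p]C[k+p]≡nCk+nC[k+p] (suc n) zero = begin
    suc (n ℕ.+ p) Cℤ p                              ≡⟨ pascal (n ℕ.+ p) p ⟨
    (n ℕ.+ p) Cℤ pred p + (n ℕ.+ p) Cℤ p            ≈⟨ +-cong-mod ([n+p]Ck≡nCk n (pred p) (ℕP.≤-reflexive (ℕP.suc-pred p)))
                                                                  ([n+p]C[k+p]≡nCk+nC[k+p] n zero) ⟩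
    n Cℤ pred p + (n Cℤ 0 + n Cℤ p)                 ≡⟨ x+[y+z]≡y+[x+z] (n Cℤ pred p) (n Cℤ 0) (n Cℤ p) ⟩
    n Cℤ 0 + (n Cℤ pred p + n Cℤ p)                 ≡⟨ cong (_+_ (n Cℤ 0)) (pascal n p) ⟩
    suc n Cℤ 0 + suc n Cℤ p                         ∎
  [n+p]C[k+p]≡nCk+nC[k+p] (suc n) (suc k) = begin
    suc (n ℕ.+ p) Cℤ suc (k ℕ.+ p)
      ≡⟨ pascal (n ℕ.+ p) (suc (k ℕ.+ p)) ⟨
    (n ℕ.+ p) Cℤ (k ℕ.+ p) + (n ℕ.+ p) Cℤ (suc k ℕ.+ p)
      ≈⟨ +-cong-mod ([n+p]C[k+p]≡nCk+nC[k+p] n k) ([n+p]C[k+p]≡nCk+nC[k+p] n (suc k)) ⟩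
    (n Cℤ k + n Cℤ (k ℕ.+ p)) + (n Cℤ suc k + n Cℤ suc (k ℕ.+ p))
      ≡⟨ +-interchange (n Cℤ k) (n Cℤ (k ℕ.+ p)) (n Cℤ suc k) (n Cℤ suc (k ℕ.+ p)) ⟩
    (n Cℤ k + n Cℤ suc k) + (n Cℤ (k ℕ.+ p) + n Cℤ suc (k ℕ.+ p))
      ≡⟨ cong₂ _+_ (pascal n (suc k)) (pascal n (suc (k ℕ.+ p))) ⟩
    suc n Cℤ suc k + suc n Cℤ suc (k ℕ.+ p)
      ∎

  lucas : ∀ n m {k r} → k < p → r < p →
          (p ℕ.* n ℕ.+ k) Cℤ (p ℕ.* m ℕ.+ r) ≡ n Cℤ m * k Cℤ r [mod p ]
  lucas zero zero {k} {r} _ _ rewrite ℕP.*-zeroʳ p =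
    ≡-mod-reflexive (sym (ℤP.*-identityˡ (k Cℤ r)))
  lucas zero (suc m) {k} {r} k<p _ rewrite ℕP.*-zeroʳ p =
    ≡-mod-reflexive (cong +_ (k>n⇒nCk≡0 k<p*[1+m]+r))
    where
    k<p*[1+m]+r : k < p ℕ.* suc m ℕ.+ r
    k<p*[1+m]+r = ℕP.<-≤-trans k<p (ℕP.≤-trans (ℕP.m≤m*n p (suc m)) (ℕP.m≤m+n _ r))
  lucas (suc n) zero {k} {r} k<p r<p = begin
    (p ℕ.* suc n ℕ.+ k) Cℤ (p ℕ.* 0 ℕ.+ r) ≡⟨ cong₂ _Cℤ_ (m*[1+n]+o≡m*n+o+m p n k) p*0+r≡r ⟩
    (p ℕ.* n ℕ.+ k ℕ.+ p) Cℤ r             ≈⟨ [n+p]Ck≡nCk (p ℕ.* n ℕ.+ k) r r<p ⟩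
    (p ℕ.* n ℕ.+ k) Cℤ r                   ≡⟨ cong ((p ℕ.* n ℕ.+ k) Cℤ_) p*0+r≡r ⟨
    (p ℕ.* n ℕ.+ k) Cℤ (p ℕ.* 0 ℕ.+ r)     ≈⟨ lucas n zero k<p r<p ⟩
    suc n Cℤ 0 * k Cℤ r                    ∎
    where
    p*0+r≡r : p ℕ.* 0 ℕ.+ r ≡ r
    p*0+r≡r = cong (ℕ._+ r) (ℕP.*-zeroʳ p)
  lucas (suc n) (suc m) {k} {r} k<p r<p = begin
    (p ℕ.* suc n ℕ.+ k) Cℤ (p ℕ.* suc m ℕ.+ r)
      ≡⟨ cong₂ _Cℤ_ (m*[1+n]+o≡m*n+o+m p n k) (m*[1+n]+o≡m*n+o+m p m r) ⟩
    (p ℕ.* n ℕ.+ k ℕ.+ p) Cℤ (p ℕ.* m ℕ.+ r ℕ.+ p)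
      ≈⟨ [n+p]C[k+p]≡nCk+nC[k+p] (p ℕ.* n ℕ.+ k) (p ℕ.* m ℕ.+ r) ⟩
    (p ℕ.* n ℕ.+ k) Cℤ (p ℕ.* m ℕ.+ r) + (p ℕ.* n ℕ.+ k) Cℤ (p ℕ.* m ℕ.+ r ℕ.+ p)
      ≡⟨ cong (λ j → (p ℕ.* n ℕ.+ k) Cℤ (p ℕ.* m ℕ.+ r) + (p ℕ.* n ℕ.+ k) Cℤ j)
              (m*[1+n]+o≡m*n+o+m p m r) ⟨
    (p ℕ.* n ℕ.+ k) Cℤ (p ℕ.* m ℕ.+ r) + (p ℕ.* n ℕ.+ k) Cℤ (p ℕ.* suc m ℕ.+ r)
      ≈⟨ +-cong-mod (lucas n m k<p r<p) (lucas n (suc m) k<p r<p) ⟩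
    n Cℤ m * k Cℤ r + n Cℤ suc m * k Cℤ r
      ≡⟨ ℤP.*-distribʳ-+ (k Cℤ r) (n Cℤ m) (n Cℤ suc m) ⟨
    (n Cℤ m + n Cℤ suc m) * k Cℤ r
      ≡⟨ cong (_* k Cℤ r) (pascal n (suc m)) ⟩
    suc n Cℤ suc m * k Cℤ r
      ∎

-1^[2+n]≡-1^n : ∀ n → -1ℤ ^ (2 ℕ.+ n) ≡ -1ℤ ^ n
-1^[2+n]≡-1^n n = trans (ℤP.^-distribˡ-+-* -1ℤ 2 n) (ℤP.*-identityˡ (-1ℤ ^ n))

negOnePow≡-1^∣m∣ : ∀ m → negOnePow m ≡ -1ℤ ^ ∣ m ∣
negOnePow≡-1^∣m∣ m = negOnePow[+n]≡-1^n ∣ m ∣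
  where
  negOnePow[+n]≡-1^n : ∀ n → negOnePow (+ n) ≡ -1ℤ ^ n
  negOnePow[+n]≡-1^n 0             = refl
  negOnePow[+n]≡-1^n 1             = refl
  negOnePow[+n]≡-1^n (suc (suc n)) = trans (negOnePow[+n]≡-1^n n) (sym (-1^[2+n]≡-1^n n))

even⊎-1^n≡-1 : ∀ n → 2 ∣ℕ n ⊎ -1ℤ ^ n ≡ -1ℤ
even⊎-1^n≡-1 0             = inj₁ (2 ∣0)
even⊎-1^n≡-1 1             = inj₂ refl
even⊎-1^n≡-1 (suc (suc n)) =
  Sum.map (∣m∣n⇒∣m+n ∣-refl) (trans (-1^[2+n]≡-1^n n)) (even⊎-1^n≡-1 n)

prime⇒-1^p≡-1 : ∀ {p} → Prime p → -1ℤ ^ p ≡ -1ℤ [mod p ]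
prime⇒-1^p≡-1 {p} p-prime with even⊎-1^n≡-1 p
... | inj₂ -1^p≡-1 = ≡-mod-reflexive -1^p≡-1
... | inj₁ 2∣p with prime⇒irreducible p-prime 2∣p
...   | inj₂ refl = mk≡mod (Signed.divides 1ℤ refl)  -- p = 2, where 1 ≡ -1

prime⇒[-1^e]^p≡-1^e : ∀ {p} → Prime p → ∀ e → (-1ℤ ^ e) ^ p ≡ -1ℤ ^ e [mod p ]
prime⇒[-1^e]^p≡-1^e {p} p-prime e = begin
  (-1ℤ ^ e) ^ p   ≡⟨ ℤP.^-*-assoc -1ℤ e p ⟩
  -1ℤ ^ (e ℕ.* p) ≡⟨ cong (-1ℤ ^_) (ℕP.*-comm e p) ⟩
  -1ℤ ^ (p ℕ.* e) ≡⟨ ℤP.^-*-assoc -1ℤ p e ⟨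
  (-1ℤ ^ p) ^ e   ≈⟨ ^-cong-mod e (prime⇒-1^p≡-1 p-prime) ⟩
  -1ℤ ^ e         ∎
  where open ≡-mod-Reasoning p

summand : ℤ → ℕ → ℕ → ℕ → ℕ → ℤ
summand s a b n j = s ^ j * (n Cℤ j) ^ a * ((2 ℕ.* n) Cℤ j) ^ b

summand-vanishes : ∀ s {a} b {n j} → 1 ≤ a → n < j → summand s a b n j ≡ 0ℤ
summand-vanishes s {suc a} b {n} {j} _ n<j =
  trans (cong (λ c → s ^ j * (+ c) ^ suc a * ((2 ℕ.* n) Cℤ j) ^ b) (k>n⇒nCk≡0 n<j))
        (cong (_* ((2 ℕ.* n) Cℤ j) ^ b) (ℤP.*-zeroʳ (s ^ j)))

u≡∑summand : ∀ ε {a} b n {l} → 1 ≤ a → n < l → u ε a b n ≡ ∑ l (summand (-1ℤ ^ ∣ ε ∣) a b n)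
u≡∑summand ε {a} b n {l} 1≤a n<l = begin
  u ε a b n
    ≡⟨ sumTo≡∑ n _ ⟩
  ∑[ j < suc n ] negOnePow (ε * + j) * (n Cℤ j) ^ a * ((2 ℕ.* n) Cℤ j) ^ b
    ≡⟨ ∑-cong (suc n) (λ j → cong (λ x → x * (n Cℤ j) ^ a * ((2 ℕ.* n) Cℤ j) ^ b) (sign j)) ⟩
  ∑ (suc n) (summand (-1ℤ ^ ∣ ε ∣) a b n)
    ≡⟨ ∑-vanishing-tail _ n<l (λ j → summand-vanishes (-1ℤ ^ ∣ ε ∣) b 1≤a) ⟨
  ∑ l (summand (-1ℤ ^ ∣ ε ∣) a b n)
    ∎
  where
  open ≡-Reasoning
  sign : ∀ j → negOnePow (ε * + j) ≡ (-1ℤ ^ ∣ ε ∣) ^ j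
  sign j = begin
    negOnePow (ε * + j)    ≡⟨ negOnePow≡-1^∣m∣ (ε * + j) ⟩
    -1ℤ ^ ∣ ε * + j ∣      ≡⟨ cong (-1ℤ ^_) (ℤP.abs-* ε (+ j)) ⟩
    -1ℤ ^ (∣ ε ∣ ℕ.* j)    ≡⟨ ℤP.^-*-assoc -1ℤ ∣ ε ∣ j ⟨
    (-1ℤ ^ ∣ ε ∣) ^ j      ∎

summand-lucas : ∀ {p} → Prime p → ∀ {s} a b → s ^ p ≡ s [mod p ] →
                ∀ n m {k r} → 2 ℕ.* k < p → r < p →
                summand s a b (p ℕ.* n ℕ.+ k) (p ℕ.* m ℕ.+ r)
                  ≡ summand s a b n m * summand s a b k r [mod p ]
summand-lucas {p} p-prime {s} a b s^p≡s n m {k} {r} 2k<p r<p = begin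
  s ^ j * (N Cℤ j) ^ a * ((2 ℕ.* N) Cℤ j) ^ b
    ≈⟨ *-cong-mod (*-cong-mod s^[p*m+r]≡s^m*s^r (^-cong-mod a (lucas p-prime n m k<p r<p)))
                  (^-cong-mod b [2*N]Cj≡[2*n]Cm*[2*k]Cr) ⟩
  (s ^ m * s ^ r) * (n Cℤ m * k Cℤ r) ^ a * ((2 ℕ.* n) Cℤ m * (2 ℕ.* k) Cℤ r) ^ b
    ≡⟨ cong₂ (λ x y → (s ^ m * s ^ r) * x * y)
             (^-distribʳ-* (n Cℤ m) (k Cℤ r) a) (^-distribʳ-* ((2 ℕ.* n) Cℤ m) ((2 ℕ.* k) Cℤ r) b) ⟩
  (s ^ m * s ^ r) * ((n Cℤ m) ^ a * (k Cℤ r) ^ a) * (((2 ℕ.* n) Cℤ m) ^ b * ((2 ℕ.* k) Cℤ r) ^ b)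
    ≡⟨ regroup (s ^ m) (s ^ r) ((n Cℤ m) ^ a) ((k Cℤ r) ^ a) (((2 ℕ.* n) Cℤ m) ^ b) (((2 ℕ.* k) Cℤ r) ^ b) ⟩
  summand s a b n m * summand s a b k r
    ∎
  where
  open ≡-mod-Reasoning p
  N j : ℕ
  N = p ℕ.* n ℕ.+ k
  j = p ℕ.* m ℕ.+ r
  k<p : k < p
  k<p = ℕP.≤-<-trans (ℕP.m≤n*m k 2) 2k<p
  s^[p*m+r]≡s^m*s^r : s ^ j ≡ s ^ m * s ^ r [mod p ]
  s^[p*m+r]≡s^m*s^r = begin
    s ^ (p ℕ.* m ℕ.+ r)    ≡⟨ ℤP.^-distribˡ-+-* s (p ℕ.* m) r ⟩
    s ^ (p ℕ.* m) * s ^ r  ≡⟨ cong (_* s ^ r) (ℤP.^-*-assoc s p m) ⟨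
    (s ^ p) ^ m * s ^ r    ≈⟨ *-cong-mod (^-cong-mod m s^p≡s) ≡-mod-refl ⟩
    s ^ m * s ^ r          ∎
  2*[p*n+k]≡p*[2*n]+2*k : ∀ p n k → 2 ℕ.* (p ℕ.* n ℕ.+ k) ≡ p ℕ.* (2 ℕ.* n) ℕ.+ 2 ℕ.* k
  2*[p*n+k]≡p*[2*n]+2*k = ℕ-solve-∀
  [2*N]Cj≡[2*n]Cm*[2*k]Cr : (2 ℕ.* N) Cℤ j ≡ (2 ℕ.* n) Cℤ m * (2 ℕ.* k) Cℤ r [mod p ]
  [2*N]Cj≡[2*n]Cm*[2*k]Cr = begin
    (2 ℕ.* N) Cℤ j                         ≡⟨ cong (_Cℤ j) (2*[p*n+k]≡p*[2*n]+2*k p n k) ⟩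
    (p ℕ.* (2 ℕ.* n) ℕ.+ 2 ℕ.* k) Cℤ j     ≈⟨ lucas p-prime (2 ℕ.* n) m 2k<p r<p ⟩
    (2 ℕ.* n) Cℤ m * (2 ℕ.* k) Cℤ r        ∎
  regroup : ∀ x y z w v t → (x * y) * (z * w) * (v * t) ≡ (x * z * v) * (y * w * t)
  regroup x y z w v t =
    trans (cong (_* (v * t)) (*-interchange x y z w)) (*-interchange (x * z) (y * w) v t)

corollary4 : (p : ℕ) → Prime p → (ε : ℤ) → (a b : ℕ) → 1 ≤ a →
    (n k : ℕ) → 2 ℕ.* k < p →
    (+ p) ∣ (u ε a b (p ℕ.* n ℕ.+ k) - u ε a b n * u ε a b k)
corollary4 p p-prime ε a b 1≤a n k 2k<p = Signed.∣⇒∣ᵤ (m∣x-y (begin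
  u ε a b (p ℕ.* n ℕ.+ k)
    ≡⟨ u≡∑summand ε b (p ℕ.* n ℕ.+ k) 1≤a p*n+k<p*[1+n] ⟩
  ∑ (p ℕ.* suc n) (F (p ℕ.* n ℕ.+ k))
    ≡⟨ ∑-* p (suc n) (F (p ℕ.* n ℕ.+ k)) ⟩
  ∑[ m < suc n ] ∑[ r < p ] F (p ℕ.* n ℕ.+ k) (p ℕ.* m ℕ.+ r)
    ≈⟨ ∑-cong-mod (suc n) (λ m _ → ∑-cong-mod p (λ r r<p →
         summand-lucas p-prime a b (prime⇒[-1^e]^p≡-1^e p-prime ∣ ε ∣) n m 2k<p r<p)) ⟩
  ∑[ m < suc n ] ∑[ r < p ] F n m * F k r
    ≡⟨ ∑*∑ (suc n) p (F n) (F k) ⟨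
  ∑ (suc n) (F n) * ∑ p (F k)
    ≡⟨ cong₂ _*_ (u≡∑summand ε b n 1≤a (ℕP.n<1+n n)) (u≡∑summand ε b k 1≤a k<p) ⟨
  u ε a b n * u ε a b k
    ∎))
  where
  open ≡-mod-Reasoning p
  F : ℕ → ℕ → ℤ
  F = summand (-1ℤ ^ ∣ ε ∣) a b
  k<p : k < p
  k<p = ℕP.≤-<-trans (ℕP.m≤n*m k 2) 2k<p
  p*n+k<p*[1+n] : p ℕ.* n ℕ.+ k < p ℕ.* suc n
  p*n+k<p*[1+n] = ℕP.<-≤-trans (ℕP.+-monoʳ-< (p ℕ.* n) k<p)
                               (ℕP.≤-reflexive (trans (ℕP.+-comm (p ℕ.* n) p) (sym (ℕP.*-suc p n))))
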